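{- The set $D$ is a clique of $G$. Furthermore, every hole of $G$ contains at most one vertex of $D$.
   Context: Graphs are finite and simple. A hole is an induced cycle of length at least $4$; a graph is chordal if it has no hole. Let $s_k=4k(\log k+\log\log k+4)$ for $k\ge2$, $s_1=2$, and $\mu_k=76s_{k+1}+3217k+1985$. Standing assumptions: $G$ is a graph, $k$ a positive integer, $C$ a shortest hole of $G$ of length strictly greater than $\mu_k$, and $G-V(C)$ is chordal. $D$ is the set of vertices of $G$ adjacent to every vertex of $C$. -}

module Defs where

open import Data.Nat as ℕ using (ℕ; zero; suc; _≤_)
open import Data.Integer as ℤ using (+_)
open import Data.Rational as ℚ using (ℚ; _/_; 0ℚ; 1ℚ)
open import Data.Fin using (Fin; toℕ)
open import Data.Bool using (Bool; true; false)
open import Data.Product using (Σ; _×_; ∃; ∃-syntax)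
open import Data.Sum using (_⊎_)
open import Data.Empty using (⊥)
open import Relation.Nullary using (¬_)
open import Relation.Binary.PropositionalEquality using (_≡_; _≢_)
open import Function.Definitions using (Injective)
open import Function.Bundles using (_⇔_)

record Graph (n : ℕ) : Set where
  field
    adj       : Fin n → Fin n → Bool
    adj-sym   : ∀ u v → adj u v ≡ adj v u
    adj-irref : ∀ v → adj v v ≡ false

open Graph public

Adj : ∀ {n} → Graph n → Fin n → Fin n → Set
Adj G u v = adj G u v ≡ true

CycConsec : (m : ℕ) → Fin m → Fin m → Set
CycConsec m i j =
    (suc (toℕ i) ≡ toℕ j)
  ⊎ (suc (toℕ j) ≡ toℕ i)
  ⊎ (toℕ i ≡ 0 × suc (toℕ j) ≡ m)
  ⊎ (toℕ j ≡ 0 × suc (toℕ i) ≡ m)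

IsHole : ∀ {n} → Graph n → (m : ℕ) → (Fin m → Fin n) → Set
IsHole G m c =
  (4 ≤ m) × Injective _≡_ _≡_ c × (∀ i j → Adj G (c i) (c j) ⇔ CycConsec m i j)

_∈V_ : ∀ {n m} → Fin n → (Fin m → Fin n) → Set
v ∈V c = ∃[ i ] c i ≡ v

IsShortestHole : ∀ {n} → Graph n → (m : ℕ) → (Fin m → Fin n) → Set
IsShortestHole {n} G m c =
  IsHole G m c × (∀ m' (h : Fin m' → Fin n) → IsHole G m' h → m ≤ m')

-- The induced subgraph G[S] is chordal: G has no hole all of whose
-- vertices lie in S (a hole of G[S] is exactly such a hole of G).
InducedChordal : ∀ {n} → Graph n → (Fin n → Set) → Set
InducedChordal {n} G S =
  ∀ m' (h : Fin m' → Fin n) → IsHole G m' h → (∀ i → S (h i)) → ⊥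

InD : ∀ {n m} → Graph n → (Fin m → Fin n) → Fin n → Set
InD G c v = ∀ i → Adj G v (c i)

IsClique : ∀ {n} → Graph n → (Fin n → Set) → Set
IsClique G S = ∀ u v → S u → S v → u ≢ v → Adj G u v

_^ᵠ_ : ℚ → ℕ → ℚ
q ^ᵠ zero  = 1ℚ
q ^ᵠ suc e = q ℚ.* (q ^ᵠ e)

-- ExpGt q y  ⇔  y < exp q.
-- Uses (1 + q/N)^N, which (for 1 + q/N > 0) increases strictly in N
-- and converges to exp q; so y < exp q iff some such term exceeds y.
ExpGt : ℚ → ℚ → Set
ExpGt q y = ∃[ N ] (0ℚ ℚ.< 1ℚ ℚ.+ q ℚ.* (+ 1 / suc N))
                 × (y ℚ.< (1ℚ ℚ.+ q ℚ.* (+ 1 / suc N)) ^ᵠ suc N)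

ℕ→ℚ : ℕ → ℚ
ℕ→ℚ m = + m / 1

-- For k ≥ 1:
--   s_{k+1} = 4(k+1)(log(k+1) + log log(k+1) + 4)
--   μ_k     = 76 s_{k+1} + 3217 k + 1985.
-- MuLt k m  ⇔  μ_k < m.
-- Encoding: μ_k < m iff there are rationals a, b with
--   log(k+1) < a   (i.e. k+1 < exp a),  0 < a,
--   log a < b      (i.e. a < exp b; then b > log log (k+1)),
--   304 (k+1) (a + b + 4) + 3217 k + 1985 < m.
-- (The expression is increasing in a, b and continuous, so this is exact.)
MuLt : ℕ → ℕ → Set
MuLt k m =
  ∃[ a ] ∃[ b ]
    (0ℚ ℚ.< a) × ExpGt a (ℕ→ℚ (suc k)) × ExpGt b a
    × (ℕ→ℚ (304 ℕ.* suc k) ℚ.* (a ℚ.+ b ℚ.+ ℕ→ℚ 4)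
         ℚ.+ ℕ→ℚ (3217 ℕ.* k ℕ.+ 1985) ℚ.< ℕ→ℚ m)

module Submission where

-- The only property of the threshold μ_k that matters is μ_k ≥ 5, so that the
-- shortest hole C has length at least 6 (module Threshold).  Its real-number
-- encoding MuLt is unpacked with the Bernoulli-type bound exp q ≤ 1/(1 - q),
-- which shows that the logarithmic part of μ_k is non-negative.
--
-- The graph part then rests on two facts about holes: a 4-cycle without
-- chords is a hole of length 4, and a hole has no triangle (three pairwise
-- cycle-consecutive positions are impossible on a cycle of length ≥ 4).
-- If u, v ∈ D were non-adjacent, u, C 0, v, C 2 would be a hole shorter than C;
-- so D is a clique.  Two vertices of D on a hole H are then adjacent, so no
-- vertex of C lies on H (it would close a triangle); thus H is a hole of
-- G - V(C), contradicting chordality.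

open import Defs

module Threshold where
  open import Data.Nat as ℕ using (ℕ; zero; suc)
  import Data.Nat.Properties as ℕP
  open import Data.Integer as ℤ using (+_)
  import Data.Integer.Properties as ℤP
  import Data.Nat.Coprimality as Coprime
  open import Data.Rational as ℚ
    using (ℚ; _/_; 0ℚ; 1ℚ; mkℚ; _≤_; _<_; _+_; _*_; -_; _-_; *≤*; *<*)
  open import Data.Rational.Properties
  open import Data.Rational.Solver using (module +-*-Solver)
  open +-*-Solver using (solve; _:+_; _:*_; _:-_; :-_; _:=_; con)
  open import Data.Product using (_,_)
  open import Data.Empty using (⊥; ⊥-elim)
  open import Relation.Nullary using (¬_; yes; no)
  open import Relation.Binary.PropositionalEquality using (_≡_; refl; sym; trans; cong; subst; subst₂)

  ℕ→ℚ-mkℚ : ∀ m → ℕ→ℚ m ≡ mkℚ (+ m) 0 (Coprime.sym (Coprime.1-coprimeTo m))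
  ℕ→ℚ-mkℚ m = normalize-coprime (Coprime.sym (Coprime.1-coprimeTo m))

  ℕ→ℚ-mono-≤ : ∀ {a b} → a ℕ.≤ b → ℕ→ℚ a ≤ ℕ→ℚ b
  ℕ→ℚ-mono-≤ {a} {b} a≤b rewrite ℕ→ℚ-mkℚ a | ℕ→ℚ-mkℚ b =
    *≤* (subst₂ ℤ._≤_ (sym (ℤP.*-identityʳ (+ a))) (sym (ℤP.*-identityʳ (+ b))) (ℤ.+≤+ a≤b))

  ℕ→ℚ-cancel-< : ∀ {a b} → ℕ→ℚ a < ℕ→ℚ b → a ℕ.< b
  ℕ→ℚ-cancel-< {a} {b} a<b rewrite ℕ→ℚ-mkℚ a | ℕ→ℚ-mkℚ b with a<b
  ... | *<* a*1<b*1 = ℤP.drop‿+<+ (subst₂ ℤ._<_ (ℤP.*-identityʳ (+ a)) (ℤP.*-identityʳ (+ b)) a*1<b*1)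

  ℕ→ℚ-nonNeg : ∀ m → 0ℚ ≤ ℕ→ℚ m
  ℕ→ℚ-nonNeg m = ℕ→ℚ-mono-≤ {0} {m} ℕ.z≤n

  ℕ→ℚ-pos : ∀ m → 0ℚ < ℕ→ℚ (suc m)
  ℕ→ℚ-pos m rewrite ℕ→ℚ-mkℚ (suc m) = *<* (ℤ.+<+ (ℕ.s≤s ℕ.z≤n))

  ℕ→ℚ-suc : ∀ m → ℕ→ℚ (suc m) ≡ 1ℚ + ℕ→ℚ m
  ℕ→ℚ-suc m rewrite ℕ→ℚ-mkℚ m =
    /-cong {+ suc m} {1} {+ 1 ℤ.* + 1 ℤ.+ + m ℤ.* + 1} {1} (sym (cong (ℤ._+_ (+ 1)) (ℤP.*-identityʳ (+ m)))) refl

  ℕ→ℚ-*-scale : ∀ N q → ℕ→ℚ (suc N) * (q * (+ 1 / suc N)) ≡ q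
  ℕ→ℚ-*-scale N q = begin
    M * (q * w)  ≡⟨ solve 3 (λ M q w → M :* (q :* w) := q :* (M :* w)) refl M q w ⟩
    q * (M * w)  ≡⟨ cong (q *_) M*w≡1 ⟩
    q * 1ℚ       ≡⟨ *-identityʳ q ⟩
    q            ∎
    where
    open Relation.Binary.PropositionalEquality.≡-Reasoning
    M = ℕ→ℚ (suc N)
    w = + 1 / suc N
    M*w≡1 : M * w ≡ 1ℚ
    M*w≡1 rewrite ℕ→ℚ-mkℚ (suc N) | normalize-coprime {1} {N} (Coprime.1-coprimeTo (suc N)) =
      *-inverseʳ (mkℚ (+ suc N) 0 (Coprime.sym (Coprime.1-coprimeTo (suc N))))

  0≤* : ∀ {p q} → 0ℚ ≤ p → 0ℚ ≤ q → 0ℚ ≤ p * q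
  0≤* {p} {q} 0≤p 0≤q = nonNegative⁻¹ (p * q) {{nonNeg*nonNeg⇒nonNeg p {{ℚ.nonNegative 0≤p}} q {{ℚ.nonNegative 0≤q}}}}

  0<* : ∀ {p q} → 0ℚ < p → 0ℚ < q → 0ℚ < p * q
  0<* {p} {q} 0<p 0<q = positive⁻¹ (p * q) {{pos*pos⇒pos p {{ℚ.positive 0<p}} q {{ℚ.positive 0<q}}}}

  0≤square : ∀ x → 0ℚ ≤ x * x
  0≤square x with 0ℚ ≤? x
  ... | yes 0≤x = 0≤* 0≤x 0≤x
  ... | no  0≰x = nonNegative⁻¹ (x * x) {{nonPos*nonPos⇒nonPos x {{x≤0}} x {{x≤0}}}}
    where x≤0 = ℚ.nonPositive (<⇒≤ (≰⇒> 0≰x))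

  0≤^ : ∀ {x} n → 0ℚ ≤ x → 0ℚ ≤ x ^ᵠ n
  0≤^ zero    _   = *≤* (ℤ.+≤+ ℕ.z≤n)
  0≤^ (suc n) 0≤x = 0≤* 0≤x (0≤^ n 0≤x)

  <⇒0<- : ∀ {p q} → p < q → 0ℚ < q - p
  <⇒0<- {p} {q} p<q = subst (_< q - p) (+-inverseʳ p) (+-monoˡ-< (- p) p<q)

  ≤+ : ∀ {p q} → 0ℚ ≤ q → p ≤ q + p
  ≤+ {p} {q} 0≤q = subst (_≤ q + p) (+-identityˡ p) (+-monoˡ-≤ p 0≤q)

  0<+ : ∀ {p q} → 0ℚ < p → 0ℚ ≤ q → 0ℚ < p + q
  0<+ {p} {q} 0<p 0≤q = subst (_< p + q) (+-identityˡ 0ℚ) (+-mono-<-≤ 0<p 0≤q)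

  -- Bernoulli-type inequality (1 + x)ⁿ (1 - n x) ≤ 1 for x ≥ -1; it bounds the
  -- sequence (1 + q/N)^N, whose supremum is exp q, by 1/(1 - q).
  bernoulli : ∀ {x} → 0ℚ ≤ 1ℚ + x → ∀ n → ((1ℚ + x) ^ᵠ n) * (1ℚ - ℕ→ℚ n * x) ≤ 1ℚ
  bernoulli {x} _ zero = ≤-reflexive (solve 1 (λ x → con 1ℚ :* (con 1ℚ :- con 0ℚ :* x) := con 1ℚ) refl x)
  bernoulli {x} 0≤1+x (suc n) = begin
    (1ℚ + x) * P * (1ℚ - ℕ→ℚ (suc n) * x)     ≡⟨ cong (λ c → (1ℚ + x) * P * (1ℚ - c * x)) (ℕ→ℚ-suc n) ⟩
    (1ℚ + x) * P * (1ℚ - (1ℚ + c) * x)         ≡⟨ solve 3 (λ P c x →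
                                                    (con 1ℚ :+ x) :* P :* (con 1ℚ :- (con 1ℚ :+ c) :* x)
                                                    := P :* (con 1ℚ :- c :* x) :- P :* (con 1ℚ :+ c) :* (x :* x)) refl P c x ⟩
    P * (1ℚ - c * x) - P * (1ℚ + c) * (x * x)  ≤⟨ +-monoʳ-≤ (P * (1ℚ - c * x)) (neg-antimono-≤ loss≥0) ⟩
    P * (1ℚ - c * x) - 0ℚ                      ≡⟨ +-identityʳ _ ⟩
    P * (1ℚ - c * x)                           ≤⟨ bernoulli 0≤1+x n ⟩
    1ℚ                                         ∎
    where
    open ≤-Reasoning
    P = (1ℚ + x) ^ᵠ n
    c = ℕ→ℚ n
    loss≥0 : 0ℚ ≤ P * (1ℚ + c) * (x * x)
    loss≥0 = 0≤* (0≤* (0≤^ n 0≤1+x) (subst (0ℚ ≤_) (ℕ→ℚ-suc n) (ℕ→ℚ-nonNeg (suc n)))) (0≤square x)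

  expGt-bound : ∀ {q y} → ExpGt q y → 0ℚ < 1ℚ - q → y * (1ℚ - q) < 1ℚ
  expGt-bound {q} {y} (N , 0<base , y<power) 0<1-q = begin-strict
    y * (1ℚ - q)                                    <⟨ *-monoˡ-<-pos (1ℚ - q) {{ℚ.positive 0<1-q}} y<power ⟩
    (base ^ᵠ suc N) * (1ℚ - q)                      ≡⟨ cong (λ r → (base ^ᵠ suc N) * (1ℚ - r)) (sym (ℕ→ℚ-*-scale N q)) ⟩
    (base ^ᵠ suc N) * (1ℚ - ℕ→ℚ (suc N) * x)        ≤⟨ bernoulli {x} (<⇒≤ 0<base) (suc N) ⟩
    1ℚ                                              ∎
    where
    open ≤-Reasoning
    x = q * (+ 1 / suc N)
    base = 1ℚ + x

  -- The exponents a > log(k+1) and b > log a witnessing μ_k < m satisfy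
  -- a + b + 4 ≥ 0.  Otherwise 1 - b ≥ 5 + a, so exp b ≤ 1/(1 - b) forces a < 1/5;
  -- but exp a ≤ 1/(1 - a) together with k + 1 ≥ 2 forces a > 1/2.
  mu-exponents-nonNeg : ∀ {k a b} → 1 ℕ.≤ k → 0ℚ < a → ExpGt a (ℕ→ℚ (suc k)) → ExpGt b a
    → 0ℚ ≤ a + b + ℕ→ℚ 4
  mu-exponents-nonNeg {k} {a} {b} 1≤k 0<a k+1<expa a<expb with 0ℚ ≤? a + b + ℕ→ℚ 4
  ... | yes 0≤sum = 0≤sum
  ... | no  0≰sum = ⊥-elim (0≮-3 0<-3)
    where
    open ≤-Reasoning
    d = 0ℚ - (a + b + ℕ→ℚ 4)
    5≤1-b : ℕ→ℚ 5 ≤ 1ℚ - b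
    5≤1-b = begin
      ℕ→ℚ 5           ≤⟨ ≤+ (<⇒≤ (0<+ 0<a (<⇒≤ (<⇒0<- (≰⇒> 0≰sum))))) ⟩
      (a + d) + ℕ→ℚ 5 ≡⟨ solve 2 (λ a b → (a :+ (con 0ℚ :- (a :+ b :+ con (ℕ→ℚ 4)))) :+ con (ℕ→ℚ 5)
                                       := con 1ℚ :- b) refl a b ⟩
      1ℚ - b          ∎
    5a<1 : a * ℕ→ℚ 5 < 1ℚ
    5a<1 = begin-strict
      a * ℕ→ℚ 5    ≤⟨ *-monoˡ-≤-nonNeg a {{ℚ.nonNegative (<⇒≤ 0<a)}} 5≤1-b ⟩
      a * (1ℚ - b) <⟨ expGt-bound {b} a<expb (<-≤-trans (ℕ→ℚ-pos 4) 5≤1-b) ⟩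
      1ℚ           ∎
    0<1-a : 0ℚ < 1ℚ - a
    0<1-a = subst (0ℚ <_) (solve 1 (λ a → (con 1ℚ :- a :* con (ℕ→ℚ 5)) :+ a :* con (ℕ→ℚ 4) := con 1ℚ :- a) refl a)
              (0<+ (<⇒0<- 5a<1) (0≤* (<⇒≤ 0<a) (ℕ→ℚ-nonNeg 4)))
    2[1-a]<1 : ℕ→ℚ 2 * (1ℚ - a) < 1ℚ
    2[1-a]<1 = begin-strict
      ℕ→ℚ 2 * (1ℚ - a)       ≤⟨ *-monoʳ-≤-nonNeg (1ℚ - a) {{ℚ.nonNegative (<⇒≤ 0<1-a)}} (ℕ→ℚ-mono-≤ (ℕ.s≤s 1≤k)) ⟩
      ℕ→ℚ (suc k) * (1ℚ - a) <⟨ expGt-bound {a} k+1<expa 0<1-a ⟩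
      1ℚ                     ∎
    0<-3 : 0ℚ < - ℕ→ℚ 3
    0<-3 = subst (0ℚ <_)
      (solve 1 (λ a → con (ℕ→ℚ 2) :* (con 1ℚ :- a :* con (ℕ→ℚ 5)) :+ con (ℕ→ℚ 5) :* (con 1ℚ :- con (ℕ→ℚ 2) :* (con 1ℚ :- a))
                      := :- con (ℕ→ℚ 3)) refl a)
      (0<+ (0<* (ℕ→ℚ-pos 1) (<⇒0<- 5a<1)) (<⇒≤ (0<* (ℕ→ℚ-pos 4) (<⇒0<- 2[1-a]<1))))
    0≮-3 : ¬ (0ℚ < - ℕ→ℚ 3)
    0≮-3 (*<* ())

  mu-large : ∀ {k m} → 1 ℕ.≤ k → MuLt k m → 5 ℕ.< m
  mu-large {k} {m} 1≤k (a , b , 0<a , k+1<expa , a<expb , μ<m) = ℕ→ℚ-cancel-< (begin-strict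
    ℕ→ℚ 5                                                  ≤⟨ ℕ→ℚ-mono-≤ 5≤c ⟩
    ℕ→ℚ c                                                  ≤⟨ ≤+ (0≤* (ℕ→ℚ-nonNeg (304 ℕ.* suc k)) log-part≥0) ⟩
    ℕ→ℚ (304 ℕ.* suc k) * (a + b + ℕ→ℚ 4) + ℕ→ℚ c         <⟨ μ<m ⟩
    ℕ→ℚ m                                                  ∎)
    where
    open ≤-Reasoning
    c = 3217 ℕ.* k ℕ.+ 1985
    5≤c : 5 ℕ.≤ c
    5≤c = ℕP.≤-trans (ℕP.m≤m+n 5 1980) (ℕP.m≤n+m 1985 (3217 ℕ.* k))
    log-part≥0 : 0ℚ ≤ a + b + ℕ→ℚ 4
    log-part≥0 = mu-exponents-nonNeg 1≤k 0<a k+1<expa a<expb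

open Threshold using (mu-large)
open import Data.Nat as ℕ using (ℕ; suc; _≤_; _<_; s≤s; z≤n)
import Data.Nat.Properties as ℕP
open import Data.Fin using (Fin; toℕ; _≟_) renaming (zero to fz; suc to fs)
import Data.Fin.Properties as FinP
open import Data.Product using (_×_; _,_)
open import Data.Sum using (_⊎_; inj₁; inj₂)
open import Data.Empty using (⊥; ⊥-elim)
open import Data.Bool using (true; false)
open import Function using (_∘_)
open import Function.Bundles using (_⇔_; mk⇔; Equivalence)
open import Relation.Binary.PropositionalEquality using (_≡_; _≢_; refl; sym; trans; cong; subst)
open import Relation.Nullary using (¬_; Dec; yes; no)
open import Relation.Nullary.Decidable using (True; False; toWitness; toWitnessFalse; _⊎-dec_; _×-dec_)

adj-symmetric : ∀ {n} (G : Graph n) {u v} → Adj G u v → Adj G v u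
adj-symmetric G {u} {v} uv = trans (adj-sym G v u) uv

adj⇒≢ : ∀ {n} (G : Graph n) {u v} → Adj G u v → u ≢ v
adj⇒≢ G {u} uv refl with trans (sym uv) (adj-irref G u)
... | ()

non-adj : ∀ {n} (G : Graph n) {u v} → adj G u v ≡ false → ¬ Adj G u v
non-adj G uv≡false uv with trans (sym uv) uv≡false
... | ()

cycConsec? : ∀ m (i j : Fin m) → Dec (CycConsec m i j)
cycConsec? m i j =
      (suc (toℕ i) ℕ.≟ toℕ j) ⊎-dec (suc (toℕ j) ℕ.≟ toℕ i)
  ⊎-dec (toℕ i ℕ.≟ 0 ×-dec suc (toℕ j) ℕ.≟ m)
  ⊎-dec (toℕ j ℕ.≟ 0 ×-dec suc (toℕ i) ℕ.≟ m)

square : ∀ {n} → Fin n → Fin n → Fin n → Fin n → Fin 4 → Fin n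
square a b c d fz = a
square a b c d (fs fz) = b
square a b c d (fs (fs fz)) = c
square a b c d (fs (fs (fs fz))) = d

square-hole : ∀ {n} (G : Graph n) {a b c d}
  → Adj G a b → Adj G b c → Adj G c d → Adj G d a
  → ¬ Adj G a c → ¬ Adj G b d → a ≢ c → b ≢ d
  → IsHole G 4 (square a b c d)
square-hole G {a} {b} {c} {d} ab bc cd da ¬ac ¬bd a≢c b≢d =
  s≤s (s≤s (s≤s (s≤s z≤n))) , injective , adjacency
  where
  h = square a b c d

  injective : ∀ {i j} → h i ≡ h j → i ≡ j
  injective {fz}             {fz}             _ = refl
  injective {fz}             {fs fz}          e = ⊥-elim (adj⇒≢ G ab e)
  injective {fz}             {fs (fs fz)}     e = ⊥-elim (a≢c e)
  injective {fz}             {fs (fs (fs fz))} e = ⊥-elim (adj⇒≢ G da (sym e))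
  injective {fs fz}          {fz}             e = ⊥-elim (adj⇒≢ G ab (sym e))
  injective {fs fz}          {fs fz}          _ = refl
  injective {fs fz}          {fs (fs fz)}     e = ⊥-elim (adj⇒≢ G bc e)
  injective {fs fz}          {fs (fs (fs fz))} e = ⊥-elim (b≢d e)
  injective {fs (fs fz)}     {fz}             e = ⊥-elim (a≢c (sym e))
  injective {fs (fs fz)}     {fs fz}          e = ⊥-elim (adj⇒≢ G bc (sym e))
  injective {fs (fs fz)}     {fs (fs fz)}     _ = refl
  injective {fs (fs fz)}     {fs (fs (fs fz))} e = ⊥-elim (adj⇒≢ G cd e)
  injective {fs (fs (fs fz))} {fz}             e = ⊥-elim (adj⇒≢ G da e)
  injective {fs (fs (fs fz))} {fs fz}          e = ⊥-elim (b≢d (sym e))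
  injective {fs (fs (fs fz))} {fs (fs fz)}     e = ⊥-elim (adj⇒≢ G cd (sym e))
  injective {fs (fs (fs fz))} {fs (fs (fs fz))} _ = refl

  edge : ∀ {i j} {_ : True (cycConsec? 4 i j)} → Adj G (h i) (h j) → Adj G (h i) (h j) ⇔ CycConsec 4 i j
  edge {i} {j} {consec} e = mk⇔ (λ _ → toWitness consec) (λ _ → e)
  non-edge : ∀ {i j} {_ : False (cycConsec? 4 i j)} → ¬ Adj G (h i) (h j) → Adj G (h i) (h j) ⇔ CycConsec 4 i j
  non-edge {i} {j} {¬consec} ¬e = mk⇔ (⊥-elim ∘ ¬e) (⊥-elim ∘ toWitnessFalse ¬consec)
  loop : ∀ i → ¬ Adj G (h i) (h i)
  loop i e = adj⇒≢ G e refl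

  adjacency : ∀ i j → Adj G (h i) (h j) ⇔ CycConsec 4 i j
  adjacency fz               fz               = non-edge (loop fz)
  adjacency fz               (fs fz)          = edge ab
  adjacency fz               (fs (fs fz))     = non-edge ¬ac
  adjacency fz               (fs (fs (fs fz))) = edge (adj-symmetric G da)
  adjacency (fs fz)          fz               = edge (adj-symmetric G ab)
  adjacency (fs fz)          (fs fz)          = non-edge (loop (fs fz))
  adjacency (fs fz)          (fs (fs fz))     = edge bc
  adjacency (fs fz)          (fs (fs (fs fz))) = non-edge ¬bd
  adjacency (fs (fs fz))     fz               = non-edge (¬ac ∘ adj-symmetric G)
  adjacency (fs (fs fz))     (fs fz)          = edge (adj-symmetric G bc)
  adjacency (fs (fs fz))     (fs (fs fz))     = non-edge (loop (fs (fs fz)))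
  adjacency (fs (fs fz))     (fs (fs (fs fz))) = edge cd
  adjacency (fs (fs (fs fz))) fz               = edge da
  adjacency (fs (fs (fs fz))) (fs fz)          = non-edge (¬bd ∘ adj-symmetric G)
  adjacency (fs (fs (fs fz))) (fs (fs fz))     = edge (adj-symmetric G cd)
  adjacency (fs (fs (fs fz))) (fs (fs (fs fz))) = non-edge (loop (fs (fs (fs fz))))

Succ : ℕ → ℕ → ℕ → Set
Succ m x y = (suc x ≡ y) ⊎ (y ≡ 0 × suc x ≡ m)

Consec : ℕ → ℕ → ℕ → Set
Consec m x y = Succ m x y ⊎ Succ m y x

consec-of-cycConsec : ∀ {m} (i j : Fin m) → CycConsec m i j → Consec m (toℕ i) (toℕ j)
consec-of-cycConsec i j (inj₁ i→j)                 = inj₁ (inj₁ i→j)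
consec-of-cycConsec i j (inj₂ (inj₁ j→i))          = inj₂ (inj₁ j→i)
consec-of-cycConsec i j (inj₂ (inj₂ (inj₁ j→0)))   = inj₂ (inj₂ j→0)
consec-of-cycConsec i j (inj₂ (inj₂ (inj₂ i→0)))   = inj₁ (inj₂ i→0)

succ-functional : ∀ {m x y z} → y < m → z < m → Succ m x y → Succ m x z → y ≡ z
succ-functional _   _   (inj₁ refl)      (inj₁ refl)      = refl
succ-functional y<m _   (inj₁ refl)      (inj₂ (_ , refl)) = ⊥-elim (ℕP.<-irrefl refl y<m)
succ-functional _   z<m (inj₂ (_ , refl)) (inj₁ refl)      = ⊥-elim (ℕP.<-irrefl refl z<m)
succ-functional _   _   (inj₂ (refl , _)) (inj₂ (refl , _)) = refl

succ-injective : ∀ {m x y z} → Succ m y x → Succ m z x → y ≡ z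
succ-injective (inj₁ refl)      (inj₁ refl)      = refl
succ-injective (inj₁ refl)      (inj₂ (() , _))
succ-injective (inj₂ (() , _))  (inj₁ refl)
succ-injective (inj₂ (_ , m≡)) (inj₂ (_ , m≡′)) = ℕP.suc-injective (trans m≡ (sym m≡′))

succ-irreflexive : ∀ {m x} → 2 ≤ m → ¬ Succ m x x
succ-irreflexive _               (inj₁ x+1≡x)    = ℕP.1+n≢n x+1≡x
succ-irreflexive (s≤s (s≤s _)) (inj₂ (refl , ()))

4≤⇒2≤ : ∀ {m} → 4 ≤ m → 2 ≤ m
4≤⇒2≤ (s≤s (s≤s _)) = s≤s (s≤s z≤n)

consec-irreflexive : ∀ {m x} → 2 ≤ m → ¬ Consec m x x
consec-irreflexive 2≤m (inj₁ x→x) = succ-irreflexive 2≤m x→x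
consec-irreflexive 2≤m (inj₂ x→x) = succ-irreflexive 2≤m x→x

no-succ-3-cycle : ∀ {m x y z} → 4 ≤ m → Succ m x y → Succ m y z → Succ m z x → ⊥
no-succ-3-cycle {x = x} _ (inj₁ refl) (inj₁ refl) (inj₁ x+3≡x) =
  ℕP.m≢1+m+n x (trans (sym x+3≡x) (cong suc (ℕP.+-comm 2 x)))
no-succ-3-cycle (s≤s (s≤s (s≤s (s≤s _)))) (inj₁ refl)      (inj₁ refl)      (inj₂ (refl , ()))
no-succ-3-cycle (s≤s (s≤s (s≤s (s≤s _)))) (inj₁ refl)      (inj₂ (refl , ())) (inj₁ refl)
no-succ-3-cycle _                          (inj₁ refl)      (inj₂ (refl , refl)) (inj₂ (_ , ()))
no-succ-3-cycle (s≤s (s≤s (s≤s (s≤s _)))) (inj₂ (refl , ())) (inj₁ refl)      (inj₁ refl)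

consec-triangle-free : ∀ {m x y z} → 4 ≤ m → x < m → y < m → z < m
  → Consec m x y → Consec m y z → Consec m x z → ⊥
consec-triangle-free 4≤m _ y<m z<m (inj₁ x→y) (inj₁ y→z) (inj₁ x→z)
  rewrite succ-functional y<m z<m x→y x→z = succ-irreflexive (4≤⇒2≤ 4≤m) y→z
consec-triangle-free 4≤m _ _ _ (inj₁ x→y) (inj₁ y→z) (inj₂ z→x) = no-succ-3-cycle 4≤m x→y y→z z→x
consec-triangle-free 4≤m _ _ _ (inj₁ x→y) (inj₂ z→y) x~z
  rewrite succ-injective x→y z→y = consec-irreflexive (4≤⇒2≤ 4≤m) x~z
consec-triangle-free 4≤m x<m _ z<m (inj₂ y→x) (inj₁ y→z) x~z
  rewrite succ-functional x<m z<m y→x y→z = consec-irreflexive (4≤⇒2≤ 4≤m) x~z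
consec-triangle-free 4≤m _ _ _ (inj₂ y→x) (inj₂ z→y) (inj₁ x→z) = no-succ-3-cycle 4≤m z→y y→x x→z
consec-triangle-free 4≤m x<m y<m _ (inj₂ y→x) (inj₂ z→y) (inj₂ z→x)
  rewrite succ-functional y<m x<m z→y z→x = succ-irreflexive (4≤⇒2≤ 4≤m) y→x

hole-adj⇒consec : ∀ {n} (G : Graph n) {m H} → IsHole G m H
  → ∀ {i j} → Adj G (H i) (H j) → Consec m (toℕ i) (toℕ j)
hole-adj⇒consec G (_ , _ , H-adj) {i} {j} e = consec-of-cycConsec i j (Equivalence.to (H-adj i j) e)

hole-triangle-free : ∀ {n} (G : Graph n) {m H} → IsHole G m H → ∀ {i j l}
  → Adj G (H i) (H j) → Adj G (H j) (H l) → Adj G (H i) (H l) → ⊥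
hole-triangle-free G hole@(4≤m , _ , _) {i} {j} {l} ij jl il =
  consec-triangle-free 4≤m (FinP.toℕ<n i) (FinP.toℕ<n j) (FinP.toℕ<n l)
    (hole-adj⇒consec G hole ij) (hole-adj⇒consec G hole jl) (hole-adj⇒consec G hole il)

-- If the shortest hole C has length at least 5, then D is a clique: two
-- non-adjacent vertices of D together with C 0 and C 2 would form a hole of
-- length 4.
D-clique : ∀ {n} (G : Graph n) {m} (C : Fin m → Fin n) → 4 < m
  → IsShortestHole G m C → IsClique G (InD G C)
D-clique G {m} C 4<m@(s≤s (s≤s (s≤s (s≤s (s≤s _))))) ((_ , C-inj , C-adj) , shortest) u v u∈D v∈D u≢v
  with adj G u v in uv
... | true  = refl
... | false = ⊥-elim (ℕP.<⇒≱ 4<m (shortest 4 (square u (C c₀) v (C c₂)) short-hole))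
  where
  c₀ c₂ : Fin m
  c₀ = fz
  c₂ = fs (fs fz)
  ¬c₀c₂ : ¬ Adj G (C c₀) (C c₂)
  ¬c₀c₂ = toWitnessFalse {a? = cycConsec? m c₀ c₂} _ ∘ Equivalence.to (C-adj c₀ c₂)
  c₀≢c₂ : C c₀ ≢ C c₂
  c₀≢c₂ e with C-inj e
  ... | ()
  short-hole : IsHole G 4 (square u (C c₀) v (C c₂))
  short-hole = square-hole G (u∈D c₀) (adj-symmetric G (v∈D c₀)) (v∈D c₂) (adj-symmetric G (u∈D c₂))
                 (non-adj G uv) ¬c₀c₂ u≢v c₀≢c₂

-- If G - V(C) is chordal and D is a clique, every hole meets D at most once:
-- two vertices of D on a hole are adjacent, so any vertex of C on that hole
-- would close a triangle; hence the hole avoids C, contradicting chordality.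
D-meets-hole-once : ∀ {n} (G : Graph n) {m} (C : Fin m → Fin n)
  → InducedChordal G (λ v → ¬ (v ∈V C)) → IsClique G (InD G C)
  → ∀ m' (H : Fin m' → Fin n) → IsHole G m' H
  → ∀ i j → InD G C (H i) → InD G C (H j) → i ≡ j
D-meets-hole-once G C chordal D-clq m' H hole@(_ , H-inj , _) i j i∈D j∈D with i ≟ j
... | yes i≡j = i≡j
... | no  i≢j = ⊥-elim (chordal m' H hole avoids-C)
  where
  avoids-C : ∀ l → ¬ (H l ∈V C)
  avoids-C l (p , Cp≡Hl) = hole-triangle-free G hole
    (D-clq (H i) (H j) i∈D j∈D (i≢j ∘ H-inj))
    (subst (Adj G (H j)) Cp≡Hl (j∈D p))
    (subst (Adj G (H i)) Cp≡Hl (i∈D p))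

lemma4p8 : ∀ {n} (G : Graph n) (k : ℕ) → 1 ≤ k
    → (m : ℕ) (C : Fin m → Fin n)
    → IsShortestHole G m C
    → MuLt k m
    → InducedChordal G (λ v → ¬ (v ∈V C))
    → IsClique G (InD G C)
      × (∀ m' (H : Fin m' → Fin n) → IsHole G m' H
           → ∀ i j → InD G C (H i) → InD G C (H j) → i ≡ j)
lemma4p8 G k 1≤k m C shortest μ<m chordal = D-is-clique , D-meets-hole-once G C chordal D-is-clique
  where
  D-is-clique : IsClique G (InD G C)
  D-is-clique = D-clique G C (ℕP.<⇒≤ (mu-large 1≤k μ<m)) shortest
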